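{- Let $n$ be a positive integer. (i) All maximal open packings of the path $P_n$ (on $n$ vertices) have the same cardinality if and only if $n\in\{1,2,3,4,8\}$. (ii) All maximal open packings of the cycle $C_n$ (with $n\ge 3$) have the same cardinality if and only if $n\in\{3,4,5,6,7,8,10,14\}$.
   Context: A set $P$ of vertices of a graph is an open packing if no two distinct vertices of $P$ have a common neighbor; a maximal open packing is one maximal under inclusion. -}

module Defs where

open import Data.Nat using (ℕ; zero; suc; _+_; NonZero)
open import Data.Nat.DivMod using (_%_)
open import Data.Fin using (Fin; toℕ)
open import Data.Fin.Subset using (Subset; _∈_; _⊆_; ∣_∣)
open import Data.Product using (_×_)
open import Data.Sum using (_⊎_)
open import Relation.Binary.PropositionalEquality using (_≡_; _≢_)
open import Relation.Nullary using (¬_)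
open import Level using (0ℓ)

Graph : ℕ → Set₁
Graph n = Fin n → Fin n → Set

pathGraph : (n : ℕ) → Graph n
pathGraph n i j = (suc (toℕ i) ≡ toℕ j) ⊎ (suc (toℕ j) ≡ toℕ i)

-- Cycle C_n (intended for n ≥ 3): i ~ j iff j ≡ i+1 (mod n) or i ≡ j+1 (mod n).
cycleGraph : (n : ℕ) → .{{_ : NonZero n}} → Graph n
cycleGraph n i j = (suc (toℕ i) % n ≡ toℕ j) ⊎ (suc (toℕ j) % n ≡ toℕ i)

IsOpenPacking : {n : ℕ} → Graph n → Subset n → Set
IsOpenPacking {n} G P =
  (u v w : Fin n) → u ∈ P → v ∈ P → u ≢ v → ¬ (G u w × G v w)

IsMaximalOpenPacking : {n : ℕ} → Graph n → Subset n → Set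
IsMaximalOpenPacking {n} G P =
  IsOpenPacking G P × ((Q : Subset n) → IsOpenPacking G Q → P ⊆ Q → Q ⊆ P)

AllMaxOpenPackingsEqual : {n : ℕ} → Graph n → Set
AllMaxOpenPackingsEqual {n} G =
  (P Q : Subset n) → IsMaximalOpenPacking G P → IsMaximalOpenPacking G Q → ∣ P ∣ ≡ ∣ Q ∣

module Submission where

-- Both graphs are successor graphs: u ~ w iff w = s u or u = s w, with s = suc for the path P_n
-- and s = suc mod n for the cycle C_n.  In such a graph two distinct vertices have a common
-- neighbour exactly when one is the second successor of the other.  Hence P is an open packing
-- iff it is *separated* (no member has its second successor in P), and a maximal one iff it is
-- moreover *covered* (every vertex is a member, the second successor of a member, or has its
-- second successor in P).  Both conditions are local: at vertex j they only involve j, its second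
-- successor and its second predecessor.  Writing P as a Boolean word and framing it (padding with
-- absent vertices for the path, wrapping around for the cycle) turns them into a condition on each
-- window of five consecutive letters, decided by the Boolean function `allWindows`.  Then
--  * for the listed n, enumerating all 2ⁿ subsets shows that all maximal open packings have one size;
--  * for the other small n, two explicit maximal open packings of different sizes are given;
--  * for large n, inserting further copies of the block 1100 into a word keeps every window
--    satisfied while adding 4 vertices and 2 members, so a few pairs of words, pumped in parallel,
--    give maximal open packings of different sizes in every residue class of n modulo 4.

open import Defs
open import Data.Bool using (Bool; true; false; _∧_; _∨_; not)
open import Data.Bool using () renaming (true to ●; false to ○)
open import Data.Bool.Properties using (T-≡)
open import Data.Empty using (⊥-elim)
open import Data.Fin using (Fin; toℕ; fromℕ<) renaming (zero to fzero; suc to fsuc)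
open import Data.Fin.Properties using (toℕ-fromℕ<; toℕ-injective; toℕ<n; any?)
open import Data.Fin.Subset using (Subset; _⊆_; ∣_∣; _∪_; ⁅_⁆) renaming (_∈_ to _∈ₛ_)
open import Data.Fin.Subset.Properties using (_∈?_; x∈p∪q⁻; p⊆p∪q; q⊆p∪q; x∈⁅x⁆; x∈⁅y⁆⇒x≡y)
open import Data.List using (List; []; _∷_; _++_; length; take)
open import Data.List.Membership.Propositional using (_∈_)
open import Data.List.Properties using (length-++; length-take; ++-assoc)
open import Data.List.Relation.Unary.Any using (here; there)
open import Data.Nat using (ℕ; zero; suc; _+_; _*_; _⊓_; _<_; _≤_; _≡ᵇ_; _≟_; z≤n; s≤s)
open import Data.Nat.DivMod using (_%_; _/_; m<n⇒m%n≡m; n%n≡0; m%n<n; m≡m%n+[m/n]*n)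
open import Data.Nat.Properties
  using (suc-injective; ≡ᵇ⇒≡; n≤1+n; ≤-refl; ≤-trans; m≤n⇒m<n∨m≡n; 1+n≢0; m+1+n≢n;
         +-comm; +-identityʳ; +-cancelʳ-≡; +-cancelˡ-<; +-monoʳ-<)
open import Data.Nat.Tactic.RingSolver using (solve-∀)
open import Data.Product using (∃; _×_; _,_; proj₁; proj₂)
open import Data.Sum using (_⊎_; inj₁; inj₂) renaming (map to map⊎)
open import Data.Vec using (toList; fromList; cast; lookup) renaming ([] to []ᵛ; _∷_ to _∷ᵛ_)
open import Data.Vec.Properties using (length-toList; toList∘fromList; toList-cast; lookup⇒[]=; []=⇒lookup)
open import Function using (_∘_)
open import Function.Bundles using (_⇔_; mk⇔; Equivalence)
open import Function.Properties.Equivalence using () renaming (trans to ⇔-trans)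
open import Relation.Nullary using (¬_; yes; no)
open import Relation.Nullary.Decidable using (_×-dec_)
open import Relation.Binary.PropositionalEquality
  using (_≡_; _≢_; refl; sym; trans; cong; cong₂; subst; subst₂; module ≡-Reasoning)

open Equivalence using (to; from)
open ≡-Reasoning

-- Boolean words.  A position outside the word is read as ○ (an absent vertex).
infixl 10 _‼_
_‼_ : List Bool → ℕ → Bool
[] ‼ _ = false
(x ∷ xs) ‼ zero = x
(x ∷ xs) ‼ suc i = xs ‼ i

‼-++ˡ : ∀ xs ys {i} → i < length xs → (xs ++ ys) ‼ i ≡ xs ‼ i
‼-++ˡ (x ∷ xs) ys {zero} _ = refl
‼-++ˡ (x ∷ xs) ys {suc i} (s≤s i<) = ‼-++ˡ xs ys i<

‼-++ʳ : ∀ xs ys i → (xs ++ ys) ‼ (length xs + i) ≡ ys ‼ i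
‼-++ʳ [] ys i = refl
‼-++ʳ (x ∷ xs) ys i = ‼-++ʳ xs ys i

‼-padded : ∀ xs i → (xs ++ false ∷ false ∷ []) ‼ i ≡ xs ‼ i
‼-padded [] zero = refl
‼-padded [] (suc zero) = refl
‼-padded [] (suc (suc i)) = refl
‼-padded (x ∷ xs) zero = refl
‼-padded (x ∷ xs) (suc i) = ‼-padded xs i

‼-take : ∀ m xs {i} → i < m → take m xs ‼ i ≡ xs ‼ i
‼-take (suc m) [] _ = refl
‼-take (suc m) (x ∷ xs) {zero} _ = refl
‼-take (suc m) (x ∷ xs) {suc i} (s≤s i<m) = ‼-take m xs i<m

reading : ∀ {x y} {A : Set} → x ≡ y → (y ≡ true ⇔ A) → (x ≡ true ⇔ A)
reading refl x⇔A = x⇔A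

members : List Bool → ℕ
members [] = 0
members (true ∷ xs) = suc (members xs)
members (false ∷ xs) = members xs

members-++ : ∀ xs ys → members (xs ++ ys) ≡ members xs + members ys
members-++ [] ys = refl
members-++ (true ∷ xs) ys = cong suc (members-++ xs ys)
members-++ (false ∷ xs) ys = members-++ xs ys

χ : ∀ {n} → Subset n → ℕ → Bool
χ P = toList P ‼_

χ-lookup : ∀ {n} (P : Subset n) (u : Fin n) → χ P (toℕ u) ≡ lookup P u
χ-lookup (x ∷ᵛ P) fzero = refl
χ-lookup (x ∷ᵛ P) (fsuc u) = χ-lookup P u

χ-bound : ∀ {n} (P : Subset n) j → χ P j ≡ true → j < n
χ-bound []ᵛ j ()
χ-bound (x ∷ᵛ P) zero _ = s≤s z≤n
χ-bound (x ∷ᵛ P) (suc j) h = s≤s (χ-bound P j h)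

χ-member : ∀ {n} {P : Subset n} {u} → χ P (toℕ u) ≡ true ⇔ u ∈ₛ P
χ-member {P = P} {u} = mk⇔ (λ h → lookup⇒[]= u P (trans (sym (χ-lookup P u)) h))
                           (λ u∈P → trans (χ-lookup P u) ([]=⇒lookup u∈P))

χ-spec : ∀ {n} {P : Subset n} {j} → χ P j ≡ true ⇔ (∃ λ u → u ∈ₛ P × toℕ u ≡ j)
χ-spec {n} {P} {j} = mk⇔ member (λ (u , u∈P , u≡j) → subst (λ i → χ P i ≡ true) u≡j (from χ-member u∈P))
  where
  member : χ P j ≡ true → ∃ λ u → u ∈ₛ P × toℕ u ≡ j
  member h = fromℕ< j<n , to χ-member (subst (λ i → χ P i ≡ true) (sym (toℕ-fromℕ< j<n)) h) , toℕ-fromℕ< j<n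
    where
    j<n : j < n
    j<n = χ-bound P j h

∣∣-members : ∀ {n} (P : Subset n) → ∣ P ∣ ≡ members (toList P)
∣∣-members []ᵛ = refl
∣∣-members (true ∷ᵛ P) = cong suc (∣∣-members P)
∣∣-members (false ∷ᵛ P) = ∣∣-members P

subsetOf : (L : List Bool) → ∀ {n} → length L ≡ n → Subset n
subsetOf L eq = cast eq (fromList L)

toList-subsetOf : ∀ L {n} (eq : length L ≡ n) → toList (subsetOf L eq) ≡ L
toList-subsetOf L eq = trans (toList-cast eq (fromList L)) (toList∘fromList L)

-- The local condition at a vertex, in terms of three letters: b = "is the second successor of a
-- member", c = "is a member", e = "its second successor is a member".
windowOK : Bool → Bool → Bool → Bool
windowOK b c e = not (c ∧ e) ∧ (c ∨ b ∨ e)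

WindowCondition : Bool → Bool → Bool → Set
WindowCondition b c e = ¬ (c ≡ true × e ≡ true) × (c ≡ true ⊎ b ≡ true ⊎ e ≡ true)

windowOK-spec : ∀ b c e → windowOK b c e ≡ true ⇔ WindowCondition b c e
windowOK-spec b true true = mk⇔ (λ ()) (λ (notBoth , _) → ⊥-elim (notBoth (refl , refl)))
windowOK-spec b true false = mk⇔ (λ _ → (λ { (_ , ()) }) , inj₁ refl) (λ _ → refl)
windowOK-spec true false true = mk⇔ (λ _ → (λ { (() , _) }) , inj₂ (inj₂ refl)) (λ _ → refl)
windowOK-spec false false true = mk⇔ (λ _ → (λ { (() , _) }) , inj₂ (inj₂ refl)) (λ _ → refl)
windowOK-spec true false false = mk⇔ (λ _ → (λ { (() , _) }) , inj₂ (inj₁ refl)) (λ _ → refl)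
windowOK-spec false false false =
  mk⇔ (λ ()) (λ { (_ , inj₁ ()) ; (_ , inj₂ (inj₁ ())) ; (_ , inj₂ (inj₂ ())) })

∧-true : ∀ {x y} → x ∧ y ≡ true ⇔ (x ≡ true × y ≡ true)
∧-true {true} = mk⇔ (λ y≡ → refl , y≡) proj₂
∧-true {false} = mk⇔ (λ ()) (λ { (() , _) })

Window : List Bool → ℕ → Set
Window w j = windowOK (w ‼ j) (w ‼ (2 + j)) (w ‼ (4 + j)) ≡ true

windows : Bool → Bool → Bool → Bool → List Bool → Bool
windows a b c d [] = true
windows a b c d (e ∷ es) = windowOK a c e ∧ windows b c d e es

windows-spec : ∀ a b c d es →
  windows a b c d es ≡ true ⇔ (∀ j → j < length es → Window (a ∷ b ∷ c ∷ d ∷ es) j)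
windows-spec a b c d [] = mk⇔ (λ _ j ()) (λ _ → refl)
windows-spec a b c d (e ∷ es) = mk⇔ every conj
  where
  every : windows a b c d (e ∷ es) ≡ true →
    ∀ j → j < suc (length es) → Window (a ∷ b ∷ c ∷ d ∷ e ∷ es) j
  every h zero _ = proj₁ (to ∧-true h)
  every h (suc j) (s≤s j<) = to (windows-spec b c d e es) (proj₂ (to ∧-true h)) j j<
  conj : (∀ j → j < suc (length es) → Window (a ∷ b ∷ c ∷ d ∷ e ∷ es) j) →
    windows a b c d (e ∷ es) ≡ true
  conj W = from ∧-true (W 0 (s≤s z≤n) , from (windows-spec b c d e es) (λ j j< → W (suc j) (s≤s j<)))

allWindows : List Bool → Bool
allWindows (a ∷ b ∷ c ∷ d ∷ es) = windows a b c d es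
allWindows _ = true

allWindows-spec : ∀ w → allWindows w ≡ true ⇔ (∀ j → 4 + j < length w → Window w j)
allWindows-spec [] = mk⇔ (λ _ j ()) (λ _ → refl)
allWindows-spec (a ∷ []) = mk⇔ (λ _ j → λ { (s≤s ()) }) (λ _ → refl)
allWindows-spec (a ∷ b ∷ []) = mk⇔ (λ _ j → λ { (s≤s (s≤s ())) }) (λ _ → refl)
allWindows-spec (a ∷ b ∷ c ∷ []) = mk⇔ (λ _ j → λ { (s≤s (s≤s (s≤s ()))) }) (λ _ → refl)
allWindows-spec (a ∷ b ∷ c ∷ d ∷ es) =
  mk⇔ (λ h j j< → to (windows-spec a b c d es) h j (+-cancelˡ-< 4 j (length es) j<))
      (λ W → from (windows-spec a b c d es) (λ j j< → W j (+-monoʳ-< 4 j<)))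

-- The successor graph of s on Fin n: u ~ w iff w = s u or u = s w.  The path and the cycle are
-- successor graphs definitionally.
successorGraph : (n : ℕ) → (ℕ → ℕ) → Graph n
successorGraph n s u w = (s (toℕ u) ≡ toℕ w) ⊎ (s (toℕ w) ≡ toℕ u)

-- The properties of s on [0, n) that determine the common neighbours.
record SuccessorLaws (n : ℕ) (s : ℕ → ℕ) : Set where
  field
    injective : ∀ {a b} → a < n → b < n → s a ≡ s b → a ≡ b
    middle-in-range : ∀ {a} → a < n → s (s a) < n → s a < n
    no-2-cycle : ∀ {a} → a < n → s (s a) ≢ a

record Decides {n : ℕ} (G : Graph n) (chk : List Bool → Bool) : Set where
  constructor deciding
  field
    decides : (P : Subset n) → IsMaximalOpenPacking G P ⇔ chk (toList P) ≡ true

module SuccessorGraph {n : ℕ} {s : ℕ → ℕ} (laws : SuccessorLaws n s) where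
  open SuccessorLaws laws

  G : Graph n
  G = successorGraph n s

  _⇝_ : Fin n → Fin n → Set
  u ⇝ v = toℕ v ≡ s (s (toℕ u))

  Separated : Subset n → Set
  Separated P = ∀ {u v} → u ∈ₛ P → v ∈ₛ P → ¬ (u ⇝ v)

  Covered : Subset n → Set
  Covered P = ∀ v → v ∈ₛ P ⊎ (∃ λ u → u ∈ₛ P × u ⇝ v) ⊎ (∃ λ w → w ∈ₛ P × v ⇝ w)

  -- Distinct vertices have a common neighbour iff one is the second successor of the other.
  openPacking⇔separated : ∀ {P} → IsOpenPacking G P ⇔ Separated P
  openPacking⇔separated {P} = mk⇔ separated packing
    where
    separated : IsOpenPacking G P → Separated P
    separated op {u} {v} u∈P v∈P u⇝v = op u v m u∈P v∈P u≢v (inj₁ (sym (toℕ-fromℕ< s[u]<n)) , inj₂ m→v)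
      where
      s[u]<n : s (toℕ u) < n
      s[u]<n = middle-in-range (toℕ<n u) (subst (_< n) u⇝v (toℕ<n v))
      m : Fin n
      m = fromℕ< s[u]<n
      m→v : s (toℕ m) ≡ toℕ v
      m→v = trans (cong s (toℕ-fromℕ< s[u]<n)) (sym u⇝v)
      u≢v : u ≢ v
      u≢v refl = no-2-cycle (toℕ<n u) (sym u⇝v)
    packing : Separated P → IsOpenPacking G P
    packing sep u v w u∈P v∈P u≢v (inj₁ u→w , inj₁ v→w) =
      u≢v (toℕ-injective (injective (toℕ<n u) (toℕ<n v) (trans u→w (sym v→w))))
    packing sep u v w u∈P v∈P u≢v (inj₁ u→w , inj₂ w→v) = sep u∈P v∈P (sym (trans (cong s u→w) w→v))
    packing sep u v w u∈P v∈P u≢v (inj₂ w→u , inj₁ v→w) = sep v∈P u∈P (sym (trans (cong s v→w) w→u))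
    packing sep u v w u∈P v∈P u≢v (inj₂ w→u , inj₂ w→v) = u≢v (toℕ-injective (trans (sym w→u) w→v))

  separated-∪ : ∀ {P} v → Separated P → ¬ (∃ λ u → u ∈ₛ P × u ⇝ v) → ¬ (∃ λ w → w ∈ₛ P × v ⇝ w) →
    Separated (P ∪ ⁅ v ⁆)
  separated-∪ {P} v sep noBelow noAbove {a} {b} a∈ b∈ a⇝b with x∈p∪q⁻ P ⁅ v ⁆ a∈ | x∈p∪q⁻ P ⁅ v ⁆ b∈
  ... | inj₁ a∈P | inj₁ b∈P = sep a∈P b∈P a⇝b
  ... | inj₁ a∈P | inj₂ b∈v = noBelow (a , a∈P , subst (a ⇝_) (x∈⁅y⁆⇒x≡y v b∈v) a⇝b)
  ... | inj₂ a∈v | inj₁ b∈P = noAbove (b , b∈P , subst (_⇝ b) (x∈⁅y⁆⇒x≡y v a∈v) a⇝b)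
  ... | inj₂ a∈v | inj₂ b∈v =
    no-2-cycle (toℕ<n v) (sym (subst₂ _⇝_ (x∈⁅y⁆⇒x≡y v a∈v) (x∈⁅y⁆⇒x≡y v b∈v) a⇝b))

  maximal⇔separated×covered : ∀ {P} → IsMaximalOpenPacking G P ⇔ (Separated P × Covered P)
  maximal⇔separated×covered {P} =
    mk⇔ (λ (op , maximality) → to openPacking⇔separated op , covered (to openPacking⇔separated op) maximality)
        (λ (sep , cov) → from openPacking⇔separated sep , maximal sep cov)
    where
    covered : Separated P → (∀ Q → IsOpenPacking G Q → P ⊆ Q → Q ⊆ P) → Covered P
    covered sep maximality v with v ∈? P
    ... | yes v∈P = inj₁ v∈P
    ... | no v∉P with any? (λ u → u ∈? P ×-dec toℕ v ≟ s (s (toℕ u)))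
    ...   | yes below = inj₂ (inj₁ below)
    ...   | no noBelow with any? (λ w → w ∈? P ×-dec toℕ w ≟ s (s (toℕ v)))
    ...     | yes above = inj₂ (inj₂ above)
    ...     | no noAbove = ⊥-elim (v∉P (maximality (P ∪ ⁅ v ⁆)
                (from openPacking⇔separated (separated-∪ v sep noBelow noAbove))
                (p⊆p∪q ⁅ v ⁆) (q⊆p∪q P ⁅ v ⁆ (x∈⁅x⁆ v))))
    maximal : Separated P → Covered P → ∀ Q → IsOpenPacking G Q → P ⊆ Q → Q ⊆ P
    maximal sep cov Q opQ P⊆Q {v} v∈Q with cov v
    ... | inj₁ v∈P = v∈P
    ... | inj₂ (inj₁ (u , u∈P , u⇝v)) = ⊥-elim (to openPacking⇔separated opQ (P⊆Q u∈P) v∈Q u⇝v)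
    ... | inj₂ (inj₂ (w , w∈P , v⇝w)) = ⊥-elim (to openPacking⇔separated opQ v∈Q (P⊆Q w∈P) v⇝w)

  record Frame (P : Subset n) (w : List Bool) : Set where
    field
      size : length w ≡ 4 + n
      below : ∀ v → w ‼ toℕ v ≡ true ⇔ (∃ λ u → u ∈ₛ P × u ⇝ v)
      centre : ∀ v → w ‼ (2 + toℕ v) ≡ true ⇔ v ∈ₛ P
      above : ∀ v → w ‼ (4 + toℕ v) ≡ true ⇔ (∃ λ u → u ∈ₛ P × v ⇝ u)

  separated×covered⇔windows : ∀ {P w} → Frame P w → (Separated P × Covered P) ⇔ (∀ v → Window w (toℕ v))
  separated×covered⇔windows {P} {w} F = mk⇔ satisfied (λ W → separated W , covered W)
    where
    open Frame F
    spec : ∀ v → Window w (toℕ v) ⇔ WindowCondition (w ‼ toℕ v) (w ‼ (2 + toℕ v)) (w ‼ (4 + toℕ v))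
    spec v = windowOK-spec (w ‼ toℕ v) (w ‼ (2 + toℕ v)) (w ‼ (4 + toℕ v))
    satisfied : Separated P × Covered P → ∀ v → Window w (toℕ v)
    satisfied (sep , cov) v =
      from (spec v) (notBoth , map⊎ (from (centre v)) (map⊎ (from (below v)) (from (above v))) (cov v))
      where
      notBoth : ¬ (w ‼ (2 + toℕ v) ≡ true × w ‼ (4 + toℕ v) ≡ true)
      notBoth (member , memberAbove) =
        let (u , u∈P , v⇝u) = to (above v) memberAbove in sep (to (centre v) member) u∈P v⇝u
    separated : (∀ v → Window w (toℕ v)) → Separated P
    separated W {u} {v} u∈P v∈P u⇝v =
      proj₁ (to (spec u) (W u)) (from (centre u) u∈P , from (above u) (v , v∈P , u⇝v))
    covered : (∀ v → Window w (toℕ v)) → Covered P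
    covered W v = map⊎ (to (centre v)) (map⊎ (to (below v)) (to (above v))) (proj₂ (to (spec v) (W v)))

  vertexWindows⇔allWindows : ∀ {w} → length w ≡ 4 + n → (∀ v → Window w (toℕ v)) ⇔ allWindows w ≡ true
  vertexWindows⇔allWindows {w} size =
    mk⇔ (λ W → from (allWindows-spec w) (λ j j< → atIndex W (+-cancelˡ-< 4 j n (subst (4 + j <_) size j<))))
        (λ A v → to (allWindows-spec w) A (toℕ v) (subst (4 + toℕ v <_) (sym size) (+-monoʳ-< 4 (toℕ<n v))))
    where
    atIndex : (∀ v → Window w (toℕ v)) → ∀ {j} → j < n → Window w j
    atIndex W j<n = subst (Window w) (toℕ-fromℕ< j<n) (W (fromℕ< j<n))

  maximal⇔allWindows : ∀ {P w} → Frame P w → IsMaximalOpenPacking G P ⇔ allWindows w ≡ true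
  maximal⇔allWindows {w = w} F =
    ⇔-trans maximal⇔separated×covered
      (⇔-trans (separated×covered⇔windows F) (vertexWindows⇔allWindows {w} (Frame.size F)))

pathLaws : ∀ {n} → SuccessorLaws n suc
pathLaws = record
  { injective = λ _ _ → suc-injective
  ; middle-in-range = λ _ 2+a<n → ≤-trans (n≤1+n _) 2+a<n
  ; no-2-cycle = λ {a} _ → m+1+n≢n 1 {a}
  }

pathWord : List Bool → List Bool
pathWord L = ○ ∷ ○ ∷ L ++ ○ ∷ ○ ∷ []

pathChk : List Bool → Bool
pathChk = allWindows ∘ pathWord

module _ {n : ℕ} where
  open SuccessorGraph (pathLaws {n})

  -- In the path word, letter j + 2 reads vertex j, letter j + 4 reads vertex j + 2, and letter j
  -- reads vertex j - 2 (absent for j < 2): the path word frames P.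
  pathFrame : (P : Subset n) → Frame P (pathWord (toList P))
  pathFrame P = record
    { size = cong (2 +_) (trans (length-++ L) (trans (cong (_+ 2) (length-toList P)) (+-comm n 2)))
    ; below = λ v → reading (reads (toℕ v)) (shifted (toℕ v))
    ; centre = λ v → reading (reads (2 + toℕ v)) χ-member
    ; above = λ v → reading (reads (4 + toℕ v)) χ-spec
    }
    where
    L : List Bool
    L = toList P
    reads : ∀ i → pathWord L ‼ i ≡ (false ∷ false ∷ L) ‼ i
    reads = ‼-padded (false ∷ false ∷ L)
    shifted : ∀ j → (false ∷ false ∷ L) ‼ j ≡ true ⇔ (∃ λ u → u ∈ₛ P × j ≡ 2 + toℕ u)
    shifted 0 = mk⇔ (λ ()) (λ { (_ , _ , ()) })
    shifted 1 = mk⇔ (λ ()) (λ { (_ , _ , ()) })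
    shifted (suc (suc i)) =
      mk⇔ (λ h → let (u , u∈P , u≡i) = to χ-spec h in u , u∈P , cong (2 +_) (sym u≡i))
          (λ (u , u∈P , 2+i≡) → from χ-spec (u , u∈P , sym (suc-injective (suc-injective 2+i≡))))

  pathDecides : Decides (pathGraph n) pathChk
  pathDecides = deciding λ P → maximal⇔allWindows (pathFrame P)

module Cycle (k : ℕ) where
  N : ℕ
  N = 3 + k

  2≢N : 2 ≢ N
  2≢N ()

  s : ℕ → ℕ
  s t = suc t % N

  s-step : ∀ {a} → a < N → (suc a < N × s a ≡ suc a) ⊎ (suc a ≡ N × s a ≡ 0)
  s-step a<N with m≤n⇒m<n∨m≡n a<N
  ... | inj₁ 1+a<N = inj₁ (1+a<N , m<n⇒m%n≡m 1+a<N)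
  ... | inj₂ 1+a≡N = inj₂ (1+a≡N , trans (cong (_% N) 1+a≡N) (n%n≡0 N))

  s-injective : ∀ {a b} → a < N → b < N → s a ≡ s b → a ≡ b
  s-injective a<N b<N sa≡sb with s-step a<N | s-step b<N
  ... | inj₁ (_ , sa) | inj₁ (_ , sb) = suc-injective (trans (sym sa) (trans sa≡sb sb))
  ... | inj₁ (_ , sa) | inj₂ (_ , sb) = ⊥-elim (1+n≢0 (trans (sym sa) (trans sa≡sb sb)))
  ... | inj₂ (_ , sa) | inj₁ (_ , sb) = ⊥-elim (1+n≢0 (trans (sym sb) (trans (sym sa≡sb) sa)))
  ... | inj₂ (1+a≡N , _) | inj₂ (1+b≡N , _) = suc-injective (trans 1+a≡N (sym 1+b≡N))

  s²-inner : ∀ {a} → 2 + a < N → s (s a) ≡ 2 + a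
  s²-inner {a} 2+a<N = trans (cong (λ t → suc t % N) (m<n⇒m%n≡m (≤-trans (n≤1+n _) 2+a<N))) (m<n⇒m%n≡m 2+a<N)

  s²-wrap₀ : ∀ {a} → 2 + a ≡ N → s (s a) ≡ 0
  s²-wrap₀ {a} 2+a≡N =
    trans (cong (λ t → suc t % N) (m<n⇒m%n≡m (subst (2 + a ≤_) 2+a≡N ≤-refl))) (trans (cong (_% N) 2+a≡N) (n%n≡0 N))

  s²-wrap₁ : ∀ {a} → 1 + a ≡ N → s (s a) ≡ 1
  s²-wrap₁ 1+a≡N = trans (cong (λ t → suc t % N) (trans (cong (_% N) 1+a≡N) (n%n≡0 N))) (m<n⇒m%n≡m 1<N)
    where
    1<N : 1 < N
    1<N = s≤s (s≤s z≤n)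

  position : ∀ {a} → a < N → 2 + a < N ⊎ 2 + a ≡ N ⊎ 1 + a ≡ N
  position a<N with m≤n⇒m<n∨m≡n a<N
  ... | inj₂ 1+a≡N = inj₂ (inj₂ 1+a≡N)
  ... | inj₁ 1+a<N with m≤n⇒m<n∨m≡n 1+a<N
  ...   | inj₁ 2+a<N = inj₁ 2+a<N
  ...   | inj₂ 2+a≡N = inj₂ (inj₁ 2+a≡N)

  -- Since N ≥ 3, no vertex is its own second successor.
  s²-no-fixpoint : ∀ {a} → a < N → s (s a) ≢ a
  s²-no-fixpoint {a} a<N s²a≡a with position a<N
  ... | inj₁ 2+a<N = m+1+n≢n 1 (trans (sym (s²-inner 2+a<N)) s²a≡a)
  ... | inj₂ (inj₁ 2+a≡N) = 2≢N (trans (cong (2 +_) (trans (sym (s²-wrap₀ 2+a≡N)) s²a≡a)) 2+a≡N)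
  ... | inj₂ (inj₂ 1+a≡N) = 2≢N (trans (cong suc (trans (sym (s²-wrap₁ 1+a≡N)) s²a≡a)) 1+a≡N)

  cycleLaws : SuccessorLaws N s
  cycleLaws = record
    { injective = s-injective
    ; middle-in-range = λ {a} _ _ → m%n<n (suc a) N
    ; no-2-cycle = s²-no-fixpoint
    }

  pred² : ℕ → ℕ
  pred² 0 = suc k
  pred² 1 = suc (suc k)
  pred² (suc (suc i)) = i

  -- pred² maps vertices to vertices, is a right inverse of s ∘ s, and by injectivity of s the inverse.
  pred²<N : ∀ {j} → j < N → pred² j < N
  pred²<N {0} _ = s≤s (s≤s (n≤1+n k))
  pred²<N {1} _ = s≤s (s≤s (s≤s ≤-refl))
  pred²<N {suc (suc i)} 2+i<N = ≤-trans (n≤1+n _) (≤-trans (n≤1+n _) 2+i<N)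

  s²-pred² : ∀ {j} → j < N → s (s (pred² j)) ≡ j
  s²-pred² {0} _ = s²-wrap₀ refl
  s²-pred² {1} _ = s²-wrap₁ refl
  s²-pred² {suc (suc i)} 2+i<N = s²-inner 2+i<N

  pred²-spec : ∀ {a b} → a < N → b < N → (b ≡ s (s a) ⇔ a ≡ pred² b)
  pred²-spec {a} {b} a<N b<N = mk⇔ cancel (λ a≡ → trans (sym (s²-pred² b<N)) (cong (s ∘ s) (sym a≡)))
    where
    cancel : b ≡ s (s a) → a ≡ pred² b
    cancel b≡ = s-injective a<N (pred²<N b<N)
      (s-injective (m%n<n (suc a) N) (m%n<n (suc (pred² b)) N) (trans (sym b≡) (sym (s²-pred² b<N))))

lastTwo : Bool → Bool → List Bool → Bool × Bool
lastTwo a b [] = a , b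
lastTwo a b (x ∷ xs) = lastTwo b x xs

lastTwo-reads : ∀ a b L → lastTwo a b L ≡ ((a ∷ b ∷ L) ‼ length L , (a ∷ b ∷ L) ‼ suc (length L))
lastTwo-reads a b [] = refl
lastTwo-reads a b (x ∷ L) = lastTwo-reads b x L

lastTwo-++ : ∀ a b xs y z ys → lastTwo a b (xs ++ y ∷ z ∷ ys) ≡ lastTwo y z ys
lastTwo-++ a b [] y z ys = refl
lastTwo-++ a b (x ∷ xs) y z ys = lastTwo-++ b x xs y z ys

cycleWord : List Bool → List Bool
cycleWord L = proj₁ ends ∷ proj₂ ends ∷ L ++ take 2 L
  where
  ends : Bool × Bool
  ends = lastTwo false false L

cycleChk : List Bool → Bool
cycleChk = allWindows ∘ cycleWord

module _ (k : ℕ) where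
  open Cycle k
  open SuccessorGraph cycleLaws

  -- In the cyclic word, letter j + 2 reads vertex j, letter j + 4 reads s (s j) and letter j reads
  -- pred² j: the cyclic word frames P.
  cycleFrame : (P : Subset N) → Frame P (cycleWord (toList P))
  cycleFrame P = record
    { size = cong (2 +_) (trans (length-++ L) (trans (cong₂ _+_ length-L length-first) (+-comm N 2)))
    ; below = λ v → reading (belowRead (toℕ<n v)) (predecessor (toℕ<n v))
    ; centre = λ v → reading (centreRead (toℕ<n v)) χ-member
    ; above = λ v → reading (aboveRead (toℕ<n v)) χ-spec
    }
    where
    L : List Bool
    L = toList P
    length-L : length L ≡ N
    length-L = length-toList P
    T : List Bool
    T = take 2 L
    length-first : length T ≡ 2
    length-first = trans (length-take 2 L) (cong (2 ⊓_) length-L)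
    inside : ∀ {j} → j < N → (L ++ T) ‼ j ≡ L ‼ j
    inside j<N = ‼-++ˡ L T (subst (_ <_) (sym length-L) j<N)
    wrapped : ∀ {i} → i < 2 → (L ++ T) ‼ (N + i) ≡ L ‼ i
    wrapped {i} i<2 = trans (cong (λ m → (L ++ T) ‼ (m + i)) (sym length-L)) (trans (‼-++ʳ L T i) (‼-take 2 L i<2))
    belowRead : ∀ {j} → j < N → cycleWord L ‼ j ≡ L ‼ pred² j
    belowRead {0} _ = trans (cong proj₁ (lastTwo-reads false false L)) (cong ((false ∷ false ∷ L) ‼_) length-L)
    belowRead {1} _ = trans (cong proj₂ (lastTwo-reads false false L)) (cong (λ m → (false ∷ false ∷ L) ‼ suc m) length-L)
    belowRead {suc (suc i)} 2+i<N = inside (≤-trans (n≤1+n _) (≤-trans (n≤1+n _) 2+i<N))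
    centreRead : ∀ {j} → j < N → cycleWord L ‼ (2 + j) ≡ L ‼ j
    centreRead = inside
    aboveRead : ∀ {j} → j < N → cycleWord L ‼ (4 + j) ≡ L ‼ s (s j)
    aboveRead {j} j<N with position j<N
    ... | inj₁ 2+j<N = trans (inside 2+j<N) (cong (L ‼_) (sym (s²-inner 2+j<N)))
    ... | inj₂ (inj₁ 2+j≡N) = trans (cong ((L ++ T) ‼_) (trans 2+j≡N (sym (+-identityʳ N))))
                                (trans (wrapped (s≤s z≤n)) (cong (L ‼_) (sym (s²-wrap₀ 2+j≡N))))
    ... | inj₂ (inj₂ 1+j≡N) = trans (cong ((L ++ T) ‼_) (trans (cong suc 1+j≡N) (+-comm 1 N)))
                                (trans (wrapped (s≤s (s≤s z≤n))) (cong (L ‼_) (sym (s²-wrap₁ 1+j≡N))))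
    predecessor : ∀ {v} → toℕ v < N → χ P (pred² (toℕ v)) ≡ true ⇔ (∃ λ u → u ∈ₛ P × u ⇝ v)
    predecessor {v} v<N =
      mk⇔ (λ h → let (u , u∈P , u≡) = to χ-spec h in u , u∈P , from (pred²-spec (toℕ<n u) v<N) u≡)
          (λ (u , u∈P , v≡) → from χ-spec (u , u∈P , to (pred²-spec (toℕ<n u) v<N) v≡))

  cycleDecides : Decides (cycleGraph N) cycleChk
  cycleDecides = deciding λ P → maximal⇔allWindows (cycleFrame P)

block : List Bool
block = ● ∷ ● ∷ ○ ∷ ○ ∷ []

blocks : ℕ → List Bool
blocks zero = []
blocks (suc q) = block ++ blocks q

pumped : List Bool → List Bool → ℕ → List Bool
pumped p s q = p ++ blocks (suc q) ++ s

windows-blocks : ∀ q ys → windows true true false false (blocks q ++ ys) ≡ windows true true false false ys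
windows-blocks zero ys = refl
windows-blocks (suc q) ys = windows-blocks q ys

windows-pump : ∀ a b c d xs ys q →
  windows a b c d (xs ++ blocks (suc q) ++ ys) ≡ windows a b c d (xs ++ blocks 1 ++ ys)
windows-pump a b c d [] ys q = cong (λ r → windowOK a c true ∧ (windowOK b d true ∧ r)) (windows-blocks q ys)
windows-pump a b c d (x ∷ xs) ys q = cong (windowOK a c x ∧_) (windows-pump b c d x xs ys q)

reassoc : ∀ (xs m ys zs : List Bool) → (xs ++ m ++ ys) ++ zs ≡ xs ++ m ++ ys ++ zs
reassoc xs m ys zs = trans (++-assoc xs (m ++ ys) zs) (cong (xs ++_) (++-assoc m ys zs))

record Pumps (chk : List Bool → Bool) (p s : List Bool) : Set where
  constructor pumping
  field
    pump : ∀ q → chk (pumped p s q) ≡ chk (pumped p s 0)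

pathPumps : ∀ {x y xs s} → Pumps pathChk (x ∷ y ∷ xs) s
pathPumps {x} {y} {xs} {s} = pumping λ q → begin
    test ((xs ++ blocks (suc q) ++ s) ++ pad)  ≡⟨ cong test (reassoc xs (blocks (suc q)) s pad) ⟩
    test (xs ++ blocks (suc q) ++ s ++ pad)    ≡⟨ windows-pump ○ ○ x y xs (s ++ pad) q ⟩
    test (xs ++ blocks 1 ++ s ++ pad)          ≡⟨ cong test (reassoc xs (blocks 1) s pad) ⟨
    test ((xs ++ blocks 1 ++ s) ++ pad)        ∎
  where
  pad : List Bool
  pad = ○ ∷ ○ ∷ []
  test : List Bool → Bool
  test = windows ○ ○ x y

-- Pumping happens inside the window test of the cyclic word (for p and s of length at least two,
-- so that the wrapped-around letters do not change).
cyclePumps : ∀ {x y xs a b ys} → Pumps cycleChk (x ∷ y ∷ xs) (a ∷ b ∷ ys)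
cyclePumps {x} {y} {xs} {a} {b} {ys} = pumping λ q → begin
    test (lastTwo x y (middle q)) (middle q ++ first)
      ≡⟨ cong₂ test (ends q) (reassoc xs (blocks (suc q)) suffix first) ⟩
    test (lastTwo a b ys) (xs ++ blocks (suc q) ++ suffix ++ first)
      ≡⟨ windows-pump a′ b′ x y xs (suffix ++ first) q ⟩
    test (lastTwo a b ys) (xs ++ blocks 1 ++ suffix ++ first)
      ≡⟨ cong₂ test (ends 0) (reassoc xs (blocks 1) suffix first) ⟨
    test (lastTwo x y (middle 0)) (middle 0 ++ first)
      ∎
  where
  suffix first : List Bool
  suffix = a ∷ b ∷ ys
  first = x ∷ y ∷ []
  middle : ℕ → List Bool
  middle q = xs ++ blocks (suc q) ++ suffix
  test : Bool × Bool → List Bool → Bool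
  test e = windows (proj₁ e) (proj₂ e) x y
  a′ b′ : Bool
  a′ = proj₁ (lastTwo a b ys)
  b′ = proj₂ (lastTwo a b ys)
  ends : ∀ q → lastTwo x y (middle q) ≡ lastTwo a b ys
  ends q = trans (cong (lastTwo x y) (sym (++-assoc xs (blocks (suc q)) suffix)))
                 (lastTwo-++ x y (xs ++ blocks (suc q)) a b ys)

pumped-additive : (f : List Bool → ℕ) → f [] ≡ 0 → (∀ xs ys → f (xs ++ ys) ≡ f xs + f ys) →
  ∀ p s q → f (pumped p s q) ≡ f (pumped p s 0) + q * f block
pumped-additive f f[] additive p s q = begin
    f (p ++ blocks (suc q) ++ s)                      ≡⟨ split (suc q) ⟩
    f p + ((1 + q) * f block + f s)                   ≡⟨ rearrange (f p) (f block) (f s) q ⟩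
    f p + (1 * f block + f s) + q * f block           ≡⟨ cong (_+ q * f block) (split 1) ⟨
    f (p ++ blocks 1 ++ s) + q * f block              ∎
  where
  f-blocks : ∀ q → f (blocks q) ≡ q * f block
  f-blocks zero = f[]
  f-blocks (suc q) = trans (additive block (blocks q)) (cong (f block +_) (f-blocks q))
  split : ∀ q → f (p ++ blocks q ++ s) ≡ f p + (q * f block + f s)
  split q = trans (additive p _) (cong (f p +_) (trans (additive (blocks q) s) (cong (_+ f s) (f-blocks q))))
  rearrange : ∀ a b c m → a + ((1 + m) * b + c) ≡ a + (1 * b + c) + m * b
  rearrange = solve-∀

everySubset : (n : ℕ) → (Subset n → Bool) → Bool
everySubset zero test = test []ᵛ
everySubset (suc n) test = everySubset n (test ∘ (true ∷ᵛ_)) ∧ everySubset n (test ∘ (false ∷ᵛ_))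

everySubset-sound : ∀ n test → everySubset n test ≡ true → ∀ P → test P ≡ true
everySubset-sound zero test h []ᵛ = h
everySubset-sound (suc n) test h (true ∷ᵛ P) = everySubset-sound n _ (proj₁ (to ∧-true h)) P
everySubset-sound (suc n) test h (false ∷ᵛ P) = everySubset-sound n _ (proj₂ (to ∧-true h)) P

module _ {n : ℕ} {G : Graph n} {chk : List Bool → Bool} (decider : Decides G chk) where
  open Decides decider

  sameSizeByEnumeration : (c : ℕ) →
    everySubset n (λ P → not (chk (toList P)) ∨ (∣ P ∣ ≡ᵇ c)) ≡ true → AllMaxOpenPackingsEqual G
  sameSizeByEnumeration c h P Q maxP maxQ = trans (size P maxP) (sym (size Q maxQ))
    where
    implies : ∀ {x y} → not x ∨ y ≡ true → x ≡ true → y ≡ true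
    implies y≡ refl = y≡
    size : ∀ P → IsMaximalOpenPacking G P → ∣ P ∣ ≡ c
    size P maxP = ≡ᵇ⇒≡ ∣ P ∣ c (from T-≡ (implies (everySubset-sound n _ h P) (to (decides P) maxP)))

  unequalWords : (L₁ L₂ : List Bool) (e₁ : length L₁ ≡ n) (e₂ : length L₂ ≡ n) →
    chk L₁ ≡ true → chk L₂ ≡ true → members L₁ ≢ members L₂ → ¬ AllMaxOpenPackingsEqual G
  unequalWords L₁ L₂ e₁ e₂ acc₁ acc₂ different same = different (begin
      members L₁  ≡⟨ size L₁ e₁ ⟨
      ∣ P₁ ∣      ≡⟨ same P₁ P₂ (maximal L₁ e₁ acc₁) (maximal L₂ e₂ acc₂) ⟩
      ∣ P₂ ∣      ≡⟨ size L₂ e₂ ⟩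
      members L₂  ∎)
    where
    P₁ P₂ : Subset n
    P₁ = subsetOf L₁ e₁
    P₂ = subsetOf L₂ e₂
    maximal : ∀ L (e : length L ≡ n) → chk L ≡ true → IsMaximalOpenPacking G (subsetOf L e)
    maximal L e acc = from (decides (subsetOf L e)) (subst (λ M → chk M ≡ true) (sym (toList-subsetOf L e)) acc)
    size : ∀ L (e : length L ≡ n) → ∣ subsetOf L e ∣ ≡ members L
    size L e = trans (∣∣-members (subsetOf L e)) (cong members (toList-subsetOf L e))

  unequalPumped : ∀ p₁ s₁ p₂ s₂ q → Pumps chk p₁ s₁ → Pumps chk p₂ s₂ →
    length (pumped p₁ s₁ 0) + q * 4 ≡ n → length (pumped p₂ s₂ 0) ≡ length (pumped p₁ s₁ 0) →
    chk (pumped p₁ s₁ 0) ≡ true → chk (pumped p₂ s₂ 0) ≡ true →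
    members (pumped p₁ s₁ 0) ≢ members (pumped p₂ s₂ 0) → ¬ AllMaxOpenPackingsEqual G
  unequalPumped p₁ s₁ p₂ s₂ q pumps₁ pumps₂ len₁ len₂ acc₁ acc₂ different =
    unequalWords (pumped p₁ s₁ q) (pumped p₂ s₂ q)
      (trans (lengthPumped p₁ s₁) len₁) (trans (lengthPumped p₂ s₂) (trans (cong (_+ q * 4) len₂) len₁))
      (trans (Pumps.pump pumps₁ q) acc₁) (trans (Pumps.pump pumps₂ q) acc₂)
      (λ same → different (+-cancelʳ-≡ (q * 2) _ _
        (trans (sym (membersPumped p₁ s₁)) (trans same (membersPumped p₂ s₂)))))
    where
    lengthPumped : ∀ p s → length (pumped p s q) ≡ length (pumped p s 0) + q * 4
    lengthPumped p s = pumped-additive length refl (λ xs ys → length-++ xs) p s q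
    membersPumped : ∀ p s → members (pumped p s q) ≡ members (pumped p s 0) + q * 2
    membersPumped p s = pumped-additive members refl members-++ p s q

byResidue : (A : ℕ → Set) → (∀ r q → r < 4 → A (r + q * 4)) → ∀ m → A m
byResidue A f m = subst A (sym (m≡m%n+[m/n]*n m 4)) (f (m % 4) (m / 4) (m%n<n m 4))

-- In the words below, ● marks a member of the packing and ○ a non-member.

longPath : ∀ r q → r < 4 → ¬ AllMaxOpenPackingsEqual (pathGraph (9 + (r + q * 4)))
longPath 0 q _ =
  unequalPumped pathDecides (○ ∷ ○ ∷ []) (○ ∷ ● ∷ ● ∷ []) (● ∷ ○ ∷ ○ ∷ []) (● ∷ ● ∷ [])
    q pathPumps pathPumps refl refl refl refl (λ ())
longPath 1 q _ =
  unequalPumped pathDecides (○ ∷ ○ ∷ []) (○ ∷ ○ ∷ ● ∷ ● ∷ []) (● ∷ ● ∷ ○ ∷ ○ ∷ []) (● ∷ ● ∷ [])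
    q pathPumps pathPumps refl refl refl refl (λ ())
longPath 2 q _ =
  unequalPumped pathDecides (○ ∷ ○ ∷ []) (○ ∷ ○ ∷ ● ∷ ● ∷ ○ ∷ []) (○ ∷ ● ∷ ● ∷ ○ ∷ ○ ∷ []) (● ∷ ● ∷ [])
    q pathPumps pathPumps refl refl refl refl (λ ())
longPath 3 q _ =
  unequalPumped pathDecides (○ ∷ ○ ∷ []) (○ ∷ ○ ∷ ● ∷ ● ∷ ○ ∷ ○ ∷ []) (○ ∷ ○ ∷ []) (● ∷ ● ∷ ○ ∷ ○ ∷ ● ∷ ● ∷ [])
    q pathPumps pathPumps refl refl refl refl (λ ())
longPath (suc (suc (suc (suc r)))) q (s≤s (s≤s (s≤s (s≤s ()))))

pathOrder : ∀ n → 1 ≤ n → AllMaxOpenPackingsEqual (pathGraph n) → n ∈ 1 ∷ 2 ∷ 3 ∷ 4 ∷ 8 ∷ []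
pathOrder 0 () _
pathOrder 1 _ _ = here refl
pathOrder 2 _ _ = there (here refl)
pathOrder 3 _ _ = there (there (here refl))
pathOrder 4 _ _ = there (there (there (here refl)))
pathOrder 5 _ same = ⊥-elim (unequalWords pathDecides
  (○ ∷ ● ∷ ● ∷ ○ ∷ ○ ∷ []) (● ∷ ● ∷ ○ ∷ ○ ∷ ● ∷ []) refl refl refl refl (λ ()) same)
pathOrder 6 _ same = ⊥-elim (unequalWords pathDecides
  (○ ∷ ○ ∷ ● ∷ ● ∷ ○ ∷ ○ ∷ []) (● ∷ ○ ∷ ○ ∷ ● ∷ ● ∷ ○ ∷ []) refl refl refl refl (λ ()) same)
pathOrder 7 _ same = ⊥-elim (unequalWords pathDecides
  (● ∷ ○ ∷ ○ ∷ ● ∷ ● ∷ ○ ∷ ○ ∷ []) (● ∷ ● ∷ ○ ∷ ○ ∷ ● ∷ ● ∷ ○ ∷ []) refl refl refl refl (λ ()) same)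
pathOrder 8 _ _ = there (there (there (there (here refl))))
pathOrder (suc (suc (suc (suc (suc (suc (suc (suc (suc m))))))))) _ same =
  ⊥-elim (byResidue (λ m → ¬ AllMaxOpenPackingsEqual (pathGraph (9 + m))) longPath m same)

pathOrderEqual : ∀ n → n ∈ 1 ∷ 2 ∷ 3 ∷ 4 ∷ 8 ∷ [] → AllMaxOpenPackingsEqual (pathGraph n)
pathOrderEqual _ (here refl) = sameSizeByEnumeration pathDecides 1 refl
pathOrderEqual _ (there (here refl)) = sameSizeByEnumeration pathDecides 2 refl
pathOrderEqual _ (there (there (here refl))) = sameSizeByEnumeration pathDecides 2 refl
pathOrderEqual _ (there (there (there (here refl)))) = sameSizeByEnumeration pathDecides 2 refl
pathOrderEqual _ (there (there (there (there (here refl))))) = sameSizeByEnumeration pathDecides 4 refl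

longCycle : ∀ r q → r < 4 → AllMaxOpenPackingsEqual (cycleGraph (11 + (r + q * 4))) →
  11 + (r + q * 4) ∈ 3 ∷ 4 ∷ 5 ∷ 6 ∷ 7 ∷ 8 ∷ 10 ∷ 14 ∷ []
longCycle 0 q _ = ⊥-elim ∘
  unequalPumped (cycleDecides (8 + q * 4)) (○ ∷ ○ ∷ ○ ∷ ○ ∷ []) (○ ∷ ● ∷ ● ∷ []) (○ ∷ ○ ∷ ● ∷ ○ ∷ ○ ∷ []) (● ∷ ● ∷ [])
    q cyclePumps cyclePumps refl refl refl refl (λ ())
longCycle 1 q _ = ⊥-elim ∘
  unequalPumped (cycleDecides (9 + q * 4)) (○ ∷ ○ ∷ ○ ∷ ○ ∷ []) (○ ∷ ○ ∷ ● ∷ ● ∷ []) (○ ∷ ○ ∷ []) (● ∷ ● ∷ ○ ∷ ○ ∷ ● ∷ ● ∷ [])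
    q cyclePumps cyclePumps refl refl refl refl (λ ())
longCycle 2 q _ = ⊥-elim ∘
  unequalPumped (cycleDecides (10 + q * 4))
    (○ ∷ ○ ∷ ○ ∷ ○ ∷ []) (● ∷ ○ ∷ ○ ∷ ● ∷ ● ∷ []) (○ ∷ ○ ∷ ○ ∷ []) (● ∷ ● ∷ ○ ∷ ○ ∷ ● ∷ ● ∷ [])
    q cyclePumps cyclePumps refl refl refl refl (λ ())
longCycle 3 zero _ _ = there (there (there (there (there (there (there (here refl)))))))
longCycle 3 (suc q) _ = ⊥-elim ∘
  unequalPumped (cycleDecides (15 + q * 4))
    (○ ∷ ○ ∷ ○ ∷ ○ ∷ []) (○ ∷ ○ ∷ ● ∷ ● ∷ ○ ∷ ○ ∷ ○ ∷ ○ ∷ ● ∷ ● ∷ [])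
    (○ ∷ ○ ∷ ○ ∷ ○ ∷ []) (● ∷ ● ∷ ○ ∷ ○ ∷ ● ∷ ● ∷ ○ ∷ ○ ∷ ● ∷ ● ∷ [])
    q cyclePumps cyclePumps refl refl refl refl (λ ())
longCycle (suc (suc (suc (suc r)))) q (s≤s (s≤s (s≤s (s≤s ())))) _

cycleOrder : ∀ k → AllMaxOpenPackingsEqual (cycleGraph (3 + k)) → 3 + k ∈ 3 ∷ 4 ∷ 5 ∷ 6 ∷ 7 ∷ 8 ∷ 10 ∷ 14 ∷ []
cycleOrder 0 _ = here refl
cycleOrder 1 _ = there (here refl)
cycleOrder 2 _ = there (there (here refl))
cycleOrder 3 _ = there (there (there (here refl)))
cycleOrder 4 _ = there (there (there (there (here refl))))
cycleOrder 5 _ = there (there (there (there (there (here refl)))))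
cycleOrder 6 same = ⊥-elim (unequalWords (cycleDecides 6)
  (● ∷ ● ∷ ○ ∷ ○ ∷ ● ∷ ● ∷ ○ ∷ ○ ∷ ○ ∷ []) (● ∷ ○ ∷ ○ ∷ ● ∷ ○ ∷ ○ ∷ ● ∷ ○ ∷ ○ ∷ [])
  refl refl refl refl (λ ()) same)
cycleOrder 7 _ = there (there (there (there (there (there (here refl))))))
cycleOrder (suc (suc (suc (suc (suc (suc (suc (suc m)))))))) =
  byResidue (λ m → AllMaxOpenPackingsEqual (cycleGraph (11 + m)) → 11 + m ∈ 3 ∷ 4 ∷ 5 ∷ 6 ∷ 7 ∷ 8 ∷ 10 ∷ 14 ∷ [])
    longCycle m

cycleOrderEqual : ∀ k → 3 + k ∈ 3 ∷ 4 ∷ 5 ∷ 6 ∷ 7 ∷ 8 ∷ 10 ∷ 14 ∷ [] →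
  AllMaxOpenPackingsEqual (cycleGraph (3 + k))
cycleOrderEqual _ (here refl) = sameSizeByEnumeration (cycleDecides 0) 1 refl
cycleOrderEqual _ (there (here refl)) = sameSizeByEnumeration (cycleDecides 1) 2 refl
cycleOrderEqual _ (there (there (here refl))) = sameSizeByEnumeration (cycleDecides 2) 2 refl
cycleOrderEqual _ (there (there (there (here refl)))) = sameSizeByEnumeration (cycleDecides 3) 2 refl
cycleOrderEqual _ (there (there (there (there (here refl))))) =
  sameSizeByEnumeration (cycleDecides 4) 3 refl
cycleOrderEqual _ (there (there (there (there (there (here refl)))))) =
  sameSizeByEnumeration (cycleDecides 5) 4 refl
cycleOrderEqual _ (there (there (there (there (there (there (here refl))))))) =
  sameSizeByEnumeration (cycleDecides 7) 4 refl
cycleOrderEqual _ (there (there (there (there (there (there (there (here refl)))))))) =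
  sameSizeByEnumeration (cycleDecides 11) 6 refl

proposition2 :
    ((n : ℕ) → 1 ≤ n →
      AllMaxOpenPackingsEqual (pathGraph n) ⇔ (n ∈ 1 ∷ 2 ∷ 3 ∷ 4 ∷ 8 ∷ []))
    ×
    ((m : ℕ) → 3 ≤ suc m →
      AllMaxOpenPackingsEqual (cycleGraph (suc m))
        ⇔ (suc m ∈ 3 ∷ 4 ∷ 5 ∷ 6 ∷ 7 ∷ 8 ∷ 10 ∷ 14 ∷ []))
proposition2 = (λ n 1≤n → mk⇔ (pathOrder n 1≤n) (pathOrderEqual n)) , cycles
  where
  cycles : ∀ m → 3 ≤ suc m →
    AllMaxOpenPackingsEqual (cycleGraph (suc m)) ⇔ (suc m ∈ 3 ∷ 4 ∷ 5 ∷ 6 ∷ 7 ∷ 8 ∷ 10 ∷ 14 ∷ [])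
  cycles 0 (s≤s ())
  cycles 1 (s≤s (s≤s ()))
  cycles (suc (suc k)) _ = mk⇔ (cycleOrder k) (cycleOrderEqual k)
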